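{- Let $n\ge1$ and $\Sigma=\{0,1,2,3\}$. Suppose $D\subseteq\Sigma^n$ is a unitrade such that there are no two double-MDS-codes $C_1,C_2\subseteq\Sigma^n$ with $\emptyset\ne C_1\triangle C_2\subseteq D$. Let $k_D$ be the integer such that $2^{k_D}$ is the number of subsets of $D$ (including $\emptyset$) that are unitrades. Then there is a testing set $T\subseteq\Sigma^n\setminus D$ for double-MDS-codes of length $n$ with $|T|=3^n-k_D$.
   Context: A line in $\Sigma^n$ is a set of $4$ words agreeing in all coordinates but one. A set $S\subseteq\Sigma^n$ is a double-MDS-code if every line contains exactly two elements of $S$, and a unitrade if every line contains an even number of elements of $S$. A set $T\subseteq\Sigma^n$ is a testing set for double-MDS-codes of length $n$ if $C_1\cap T\ne C_2\cap T$ for any two different double-MDS-codes $C_1,C_2\subseteq\Sigma^n$. $\triangle$ denotes symmetric difference. -}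

module Defs where

open import Data.Nat using (ℕ; zero; suc; _+_; _%_; _≡ᵇ_)
open import Data.Bool using (Bool; true; false; if_then_else_; _xor_; _∧_)
open import Data.Fin using (Fin)
open import Data.Vec using (Vec; []; _∷_; _[_]≔_)
open import Data.Vec.Properties using () renaming (≡-dec to vec-≡-dec)
open import Data.Fin.Properties using () renaming (_≟_ to _≟ᶠ_)
open import Data.List using (List; []; _∷_; map; concatMap; filterᵇ; length; allFin; _++_)
open import Data.Bool.ListAction using (all; any)
open import Data.Product using (∃; _×_; _,_)
open import Relation.Nullary using (¬_; does)
open import Relation.Binary.PropositionalEquality using (_≡_; _≢_)

Σ : Set
Σ = Fin 4

Word : ℕ → Set
Word n = Vec Σ n

Subset : ℕ → Set
Subset n = Word n → Bool

allWords : (n : ℕ) → List (Word n)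
allWords zero = [] ∷ []
allWords (suc n) = concatMap (λ a → map (a ∷_) (allWords n)) (allFin 4)

∣_∣ : ∀ {n} → Subset n → ℕ
∣_∣ {n} S = length (filterᵇ S (allWords n))

lineCount : ∀ {n} → Subset n → Word n → Fin n → ℕ
lineCount S w i = length (filterᵇ (λ a → S (w [ i ]≔ a)) (allFin 4))

DoubleMDS : ∀ {n} → Subset n → Set
DoubleMDS {n} S = ∀ (w : Word n) (i : Fin n) → lineCount S w i ≡ 2

isUnitrade : ∀ {n} → Subset n → Bool
isUnitrade {n} S =
  all (λ w → all (λ i → (lineCount S w i % 2) ≡ᵇ 0) (allFin n)) (allWords n)

Unitrade : ∀ {n} → Subset n → Set
Unitrade S = isUnitrade S ≡ true

memb : ∀ {n} → List (Word n) → Subset n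
memb L w = any (λ v → does (vec-≡-dec _≟ᶠ_ w v)) L

sublists : ∀ {A : Set} → List A → List (List A)
sublists [] = [] ∷ []
sublists (x ∷ xs) = let r = sublists xs in r ++ map (x ∷_) r

-- number of subsets of D (including ∅) which are unitrades
-- (subsets of D are enumerated as sublists of the repetition-free list of elements of D)
numUnitradeSubsets : ∀ {n} → Subset n → ℕ
numUnitradeSubsets {n} D =
  length (filterᵇ (λ L → isUnitrade (memb L))
                 (sublists (filterᵇ D (allWords n))))

SameSet : ∀ {n} → Subset n → Subset n → Set
SameSet {n} A B = ∀ (w : Word n) → A w ≡ B w

SameOn : ∀ {n} → Subset n → Subset n → Subset n → Set
SameOn {n} T A B = ∀ (w : Word n) → (T w ∧ A w) ≡ (T w ∧ B w)

TestingSet : ∀ {n} → Subset n → Set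
TestingSet {n} T = ∀ (C₁ C₂ : Subset n) → DoubleMDS C₁ → DoubleMDS C₂ →
  ¬ SameSet C₁ C₂ → ¬ SameOn T C₁ C₂

NoCodePairIn : ∀ {n} → Subset n → Set
NoCodePairIn {n} D = ¬ (∃ λ (C₁ : Subset n) → ∃ λ (C₂ : Subset n) →
  DoubleMDS C₁ × DoubleMDS C₂ ×
  (∃ λ (w : Word n) → (C₁ w xor C₂ w) ≡ true) ×
  (∀ (w : Word n) → (C₁ w xor C₂ w) ≡ true → D w ≡ true))

module Submission where

-- The unitrades form a GF(2)-subspace of the subsets of Σⁿ.  Gaussian elimination over
-- the words outside a set P (a word becomes a pivot when some unitrade supported on it and
-- the words not yet visited contains it) gives a set T of pivots outside P with
-- #unitrades = #(unitrades inside P) · 2^|T|, such that every unitrade vanishing on T lies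
-- inside P.  For P = words containing the letter 3 this gives 2^(3ⁿ) unitrades: a unitrade
-- vanishing on {0,1,2}ⁿ is empty (on each line parity forces the entry with letter 3), and
-- for y ∈ {0,1,2}ⁿ the subcube ∏ᵢ {yᵢ, 3} is a unitrade meeting {0,1,2}ⁿ only in y, so
-- every such y is a pivot.  For P = D this gives 2^(3ⁿ) = 2^k · 2^|T|; and two double-MDS
-- codes agreeing on T differ by a unitrade vanishing on T, i.e. by a subset of D.

open import Defs
open import Data.Nat using (ℕ; zero; suc; _+_; _*_; _^_; _%_; _≡ᵇ_; _≤_; s≤s; z≤n)
open import Data.Nat.Properties
  using (+-comm; +-identityʳ; *-identityʳ; *-identityˡ; *-comm; *-distribˡ-+; +-commutativeSemigroup;
         <-cmp; <⇒≢; ^-monoʳ-<; ^-distribˡ-+-*)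
open import Data.Bool using (Bool; true; false; not; T?; _∧_; _∨_; _xor_)
open import Data.Bool.Properties
  using (∧-identityʳ; ∧-zeroʳ; ∨-zeroʳ; xor-same; xor-identityʳ; xor-assoc; not-injective; T-≡; ⇔→≡; xor-∧-commutativeRing; not-involutive)
open import Data.Bool.ListAction using (all)
open import Data.Fin using (zero; suc)
open import Data.Vec using ([]; _∷_; _[_]≔_)
open import Data.Vec.Properties using (∷-injective) renaming (≡-dec to vec-≡-dec)
open import Data.Fin.Properties using () renaming (_≟_ to _≟ᶠ_)
open import Data.List using (List; []; _∷_; _++_; map; length; filterᵇ; allFin; cartesianProductWith)
open import Data.Nat.ListAction using (sum)
open import Data.List.Membership.Propositional using (_∈_; _∉_)
open import Data.List.Membership.Propositional.Properties
  using (∈-allFin; ∈-cartesianProductWith⁺; ∈-filter⁻; ∈-++⁺ˡ; ∈-++⁺ʳ; ∈-++⁻; ∈-map⁺; ∈-map⁻)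
open import Data.List.Relation.Unary.Any using (here; there)
open import Data.List.Relation.Unary.All as All using ([])
open import Data.List.Relation.Unary.All.Properties using (all⁺; all⁻)
open import Data.List.Relation.Unary.AllPairs using ([]; _∷_)
open import Data.List.Relation.Unary.Unique.Propositional using (Unique)
open import Data.List.Relation.Unary.Unique.Propositional.Properties
  using (cartesianProductWith⁺; allFin⁺; Unique[x∷xs]⇒x∉xs)
open import Data.List.Relation.Binary.Permutation.Propositional
  using (_↭_; refl; prep; swap; trans; ↭-sym; ↭⇒↭ₛ)
open import Data.List.Relation.Binary.Permutation.Propositional.Properties using (shift; Any-resp-↭)
import Data.List.Relation.Binary.Permutation.Setoid.Properties as Permutationₛ
open import Data.Product using (∃; _×_; _,_; proj₁; proj₂)
open import Data.Sum using (_⊎_; inj₁; inj₂)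
open import Function using (_∘_; _∘₂_; Equivalence; mk⇔)
open import Relation.Binary using (DecidableEquality; tri<; tri≈; tri>)
open import Relation.Binary.PropositionalEquality as ≡
  using (_≡_; _≢_; refl; sym; cong; cong₂; module ≡-Reasoning)
open import Relation.Nullary using (does; yes; no; contradiction)
open import Algebra.Properties.CommutativeSemigroup using (interchange)
import Algebra.Bundles as Bundles

open ≡-Reasoning

count : {A : Set} → (A → Bool) → List A → ℕ
count p xs = length (filterᵇ p xs)

module _ {A : Set} where

  count-++ : ∀ (p : A → Bool) xs ys → count p (xs ++ ys) ≡ count p xs + count p ys
  count-++ p []       ys = refl
  count-++ p (x ∷ xs) ys with p x
  ... | true  = cong suc (count-++ p xs ys)
  ... | false = count-++ p xs ys

  count-map : ∀ {B : Set} (p : A → Bool) (f : B → A) xs → count p (map f xs) ≡ count (p ∘ f) xs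
  count-map p f []       = refl
  count-map p f (x ∷ xs) with p (f x)
  ... | true  = cong suc (count-map p f xs)
  ... | false = count-map p f xs

  count-cong : ∀ {p q : A → Bool} xs → (∀ {x} → x ∈ xs → p x ≡ q x) → count p xs ≡ count q xs
  count-cong []       _   = refl
  count-cong {p} {q} (x ∷ xs) p≗q with p x | q x | p≗q (here refl)
  ... | true  | .true  | refl = cong suc (count-cong xs (p≗q ∘ there))
  ... | false | .false | refl = count-cong xs (p≗q ∘ there)

  count-none : ∀ {p : A → Bool} xs → (∀ {x} → x ∈ xs → p x ≡ false) → count p xs ≡ 0
  count-none         []       _    = refl
  count-none {p} (x ∷ xs) none with p x | none (here refl)
  ... | false | refl = count-none xs (none ∘ there)

  none-or-witness : ∀ (p : A → Bool) xs → (∀ {x} → x ∈ xs → p x ≡ false) ⊎ ∃ λ x → x ∈ xs × p x ≡ true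
  none-or-witness p []       = inj₁ λ ()
  none-or-witness p (x ∷ xs) with p x in px | none-or-witness p xs
  ... | true  | _                  = inj₂ (x , here refl , px)
  ... | false | inj₂ (y , y∈ , py) = inj₂ (y , there y∈ , py)
  ... | false | inj₁ none          = inj₁ λ { (here refl) → px ; (there y∈) → none y∈ }

  ∈-filterᵇ⁻ : ∀ (p : A → Bool) {xs x} → x ∈ filterᵇ p xs → p x ≡ true
  ∈-filterᵇ⁻ p {xs} x∈ = Equivalence.to T-≡ (proj₂ (∈-filter⁻ (T? ∘ p) {xs = xs} x∈))

  all-≡-true⁻ : ∀ (p : A → Bool) xs → all p xs ≡ true → ∀ {x} → x ∈ xs → p x ≡ true
  all-≡-true⁻ p xs h x∈ = Equivalence.to T-≡ (All.lookup (all⁺ p xs (Equivalence.from T-≡ h)) x∈)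

  all-≡-true⁺ : ∀ (p : A → Bool) xs → (∀ {x} → x ∈ xs → p x ≡ true) → all p xs ≡ true
  all-≡-true⁺ p xs h = Equivalence.to T-≡ (all⁻ p (All.tabulate (Equivalence.from T-≡ ∘ h)))

  filterᵇ-complement-↭ : ∀ {p q : A → Bool} → (∀ x → q x ≡ not (p x)) →
                         ∀ xs → filterᵇ p xs ++ filterᵇ q xs ↭ xs
  filterᵇ-complement-↭ q≡¬p [] = refl
  filterᵇ-complement-↭ {p} {q} q≡¬p (x ∷ xs) with p x | q x | q≡¬p x
  ... | true  | .false | refl = prep x (filterᵇ-complement-↭ q≡¬p xs)
  ... | false | .true  | refl = trans (shift x _ _) (prep x (filterᵇ-complement-↭ q≡¬p xs))

count-cartesianProductWith : ∀ {A B C : Set} (p : C → Bool) (f : A → B → C) xs ys →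
  count p (cartesianProductWith f xs ys) ≡ sum (map (λ x → count (p ∘ f x) ys) xs)
count-cartesianProductWith p f []       ys = refl
count-cartesianProductWith p f (x ∷ xs) ys = ≡.trans (count-++ p (map (f x) ys) _)
  (cong₂ _+_ (count-map p (f x) ys) (count-cartesianProductWith p f xs ys))

Unique-resp-↭ : ∀ {A : Set} {xs ys : List A} → xs ↭ ys → Unique xs → Unique ys
Unique-resp-↭ p = Permutationₛ.Unique-resp-↭ (≡.setoid _) (↭⇒↭ₛ p)

∧-true⁻ : ∀ a {b} → a ∧ b ≡ true → a ≡ true × b ≡ true
∧-true⁻ true b≡true = refl , b≡true

odd : ℕ → Bool
odd zero    = false
odd (suc m) = not (odd m)

%2≡ᵇ0≡not-odd : ∀ m → (m % 2 ≡ᵇ 0) ≡ not (odd m)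
%2≡ᵇ0≡not-odd zero          = refl
%2≡ᵇ0≡not-odd (suc zero)    = refl
%2≡ᵇ0≡not-odd (suc (suc m)) = ≡.trans (%2≡ᵇ0≡not-odd m) (cong not (sym (not-involutive (odd m))))

odd-count-∷ : ∀ {A : Set} (p : A → Bool) x xs → odd (count p (x ∷ xs)) ≡ p x xor odd (count p xs)
odd-count-∷ p x xs with p x
... | true  = refl
... | false = refl

odd-count-xor : ∀ {A : Set} (p q : A → Bool) xs →
                odd (count (λ x → p x xor q x) xs) ≡ odd (count p xs) xor odd (count q xs)
odd-count-xor p q []       = refl
odd-count-xor p q (x ∷ xs) = begin
  odd (count p⊕q (x ∷ xs))                                  ≡⟨ odd-count-∷ p⊕q x xs ⟩
  (p x xor q x) xor odd (count p⊕q xs)                      ≡⟨ cong ((p x xor q x) xor_) (odd-count-xor p q xs) ⟩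
  (p x xor q x) xor (odd (count p xs) xor odd (count q xs)) ≡⟨ xor-interchange (p x) (q x) _ _ ⟩
  (p x xor odd (count p xs)) xor (q x xor odd (count q xs)) ≡⟨ sym (cong₂ _xor_ (odd-count-∷ p x xs) (odd-count-∷ q x xs)) ⟩
  odd (count p (x ∷ xs)) xor odd (count q (x ∷ xs))         ∎
  where
  p⊕q = λ x → p x xor q x
  xor-interchange = interchange (Bundles.CommutativeRing.+-commutativeSemigroup xor-∧-commutativeRing)

2^-injective : ∀ {m n} → 2 ^ m ≡ 2 ^ n → m ≡ n
2^-injective {m} {n} 2^m≡2^n with <-cmp m n
... | tri< m<n _ _ = contradiction 2^m≡2^n (<⇒≢ (^-monoʳ-< 2 (s≤s (s≤s z≤n)) m<n))
... | tri≈ _ m≡n _ = m≡n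
... | tri> _ _ n<m = contradiction (sym 2^m≡2^n) (<⇒≢ (^-monoʳ-< 2 (s≤s (s≤s z≤n)) n<m))

allWords-complete : ∀ n (w : Word n) → w ∈ allWords n
allWords-complete zero    []      = here refl
allWords-complete (suc n) (a ∷ w) = ∈-cartesianProductWith⁺ _∷_ (∈-allFin a) (allWords-complete n w)

allWords-unique : ∀ n → Unique (allWords n)
allWords-unique zero    = [] ∷ []
allWords-unique (suc n) = cartesianProductWith⁺ _∷_ ∷-injective (allFin⁺ 4) (allWords-unique n)

module _ {n : ℕ} where

  _≟ʷ_ : DecidableEquality (Word n)
  _≟ʷ_ = vec-≡-dec _≟ᶠ_

  ∅ : Subset n
  ∅ _ = false

  _⊕_ : Subset n → Subset n → Subset n
  (f ⊕ g) w = f w xor g w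

  -- Chosen so that memb (x ∷ S) reduces to insert x (memb S).
  insert : Word n → Subset n → Subset n
  insert x f w = does (w ≟ʷ x) ∨ f w

  erase : Word n → Subset n → Subset n
  erase x f w = f w ∧ not (does (w ≟ʷ x))

  _⊆ᴸ_ : Subset n → List (Word n) → Set
  f ⊆ᴸ xs = ∀ {w} → f w ≡ true → w ∈ xs

  Disjoint : Subset n → Subset n → Set
  Disjoint f g = ∀ {w} → g w ≡ true → f w ≡ false

  insert-self : ∀ x f → insert x f x ≡ true
  insert-self x f with x ≟ʷ x
  ... | yes _   = refl
  ... | no x≢x = contradiction refl x≢x

  insert-≢ : ∀ {x w} f → w ≢ x → insert x f w ≡ f w
  insert-≢ {x} {w} f w≢x with w ≟ʷ x
  ... | yes w≡x = contradiction w≡x w≢x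
  ... | no _    = refl

  insert-extends : ∀ {x w} f → f w ≡ true → insert x f w ≡ true
  insert-extends {x} {w} f fw rewrite fw = ∨-zeroʳ (does (w ≟ʷ x))

  insert-cong : ∀ x {f g} → (∀ w → f w ≡ g w) → ∀ w → insert x f w ≡ insert x g w
  insert-cong x f≗g w = cong (does (w ≟ʷ x) ∨_) (f≗g w)

  insert-⊆ : ∀ {x f xs} → f ⊆ᴸ xs → insert x f ⊆ᴸ (x ∷ xs)
  insert-⊆ {x} {f} f⊆ {w} fw with w ≟ʷ x
  ... | yes refl = here refl
  ... | no _     = there (f⊆ fw)

  insert-comm : ∀ x y f w → insert x (insert y f) w ≡ insert y (insert x f) w
  insert-comm x y f w with does (w ≟ʷ x) | does (w ≟ʷ y)
  ... | true  | true  = refl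
  ... | true  | false = refl
  ... | false | _     = refl

  ⊆-∉ : ∀ {f xs x} → f ⊆ᴸ xs → x ∉ xs → f x ≡ false
  ⊆-∉ {f} {xs} {x} f⊆ x∉ with f x in fx
  ... | false = refl
  ... | true  = contradiction (f⊆ fx) x∉

  ⊆-∷⁻ : ∀ {x f xs} → f x ≡ false → f ⊆ᴸ (x ∷ xs) → f ⊆ᴸ xs
  ⊆-∷⁻ fx f⊆ fw with f⊆ fw
  ... | here refl = contradiction (≡.trans (sym fw) fx) λ ()
  ... | there w∈  = w∈

  erase-⊆ : ∀ {x f xs} → f ⊆ᴸ (x ∷ xs) → erase x f ⊆ᴸ xs
  erase-⊆ {x} {f} f⊆ {w} efw with w ≟ʷ x
  ... | yes refl = contradiction (≡.trans (sym efw) (∧-zeroʳ (f x))) λ ()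
  ... | no w≢x with f⊆ (≡.trans (sym (∧-identityʳ (f w))) efw)
  ...   | here w≡x = contradiction w≡x w≢x
  ...   | there w∈ = w∈

  erase-id : ∀ {x f} → f x ≡ false → ∀ w → erase x f w ≡ f w
  erase-id {x} {f} fx w with w ≟ʷ x
  ... | yes refl = ≡.trans (∧-zeroʳ (f x)) (sym fx)
  ... | no _     = ∧-identityʳ (f w)

  insert-erase : ∀ {x f} → f x ≡ true → ∀ w → insert x (erase x f) w ≡ f w
  insert-erase {x} {f} fx w with w ≟ʷ x
  ... | yes refl = sym fx
  ... | no _     = ∧-identityʳ (f w)

  ⊆-[] : ∀ {f} → f ⊆ᴸ [] → ∀ w → f w ≡ false
  ⊆-[] {f} f⊆ w with f w in fw
  ... | false = refl
  ... | true with f⊆ fw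
  ...   | ()

  ⊕≗⊕-erase : ∀ {x g} f → g x ≡ false → ∀ w → (f ⊕ g) w ≡ (f ⊕ erase x g) w
  ⊕≗⊕-erase f gx w = cong (f w xor_) (sym (erase-id gx w))

  insert-⊕≗insert-⊕-erase : ∀ {x g} f → g x ≡ false → ∀ w → (insert x f ⊕ g) w ≡ insert x (f ⊕ erase x g) w
  insert-⊕≗insert-⊕-erase {x} {g} f gx w with w ≟ʷ x
  ... | yes refl = cong not gx
  ... | no _     = cong (f w xor_) (sym (∧-identityʳ (g w)))

  ⊕≗insert-⊕-erase : ∀ {x f g} → f x ≡ false → g x ≡ true → ∀ w → (f ⊕ g) w ≡ insert x (f ⊕ erase x g) w
  ⊕≗insert-⊕-erase {x} {f} {g} fx gx w with w ≟ʷ x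
  ... | yes refl rewrite fx | gx = refl
  ... | no _     = cong (f w xor_) (sym (∧-identityʳ (g w)))

  insert-⊕≗⊕-erase : ∀ {x f g} → f x ≡ false → g x ≡ true → ∀ w → (insert x f ⊕ g) w ≡ (f ⊕ erase x g) w
  insert-⊕≗⊕-erase {x} {f} {g} fx gx w with w ≟ʷ x
  ... | yes refl rewrite fx | gx = refl
  ... | no _     = cong (f w xor_) (sym (∧-identityʳ (g w)))

  ⊕-cancelʳ : ∀ f g w → ((f ⊕ g) ⊕ g) w ≡ f w
  ⊕-cancelʳ f g w = begin
    (f w xor g w) xor g w ≡⟨ xor-assoc (f w) (g w) (g w) ⟩
    f w xor (g w xor g w) ≡⟨ cong (f w xor_) (xor-same (g w)) ⟩
    f w xor false         ≡⟨ xor-identityʳ (f w) ⟩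
    f w                   ∎

  insert≗⊕ : ∀ {x f g} → f x ≡ false → g x ≡ false → ∀ w → insert x f w ≡ ((f ⊕ g) ⊕ insert x g) w
  insert≗⊕ {x} {f} {g} fx gx w with w ≟ʷ x
  ... | yes refl rewrite fx | gx = refl
  ... | no _     = sym (⊕-cancelʳ f g w)

  countSubsets : (Subset n → Bool) → List (Word n) → ℕ
  countSubsets Q xs = count (Q ∘ memb) (sublists xs)

  Extensional : (Subset n → Bool) → Set
  Extensional Q = ∀ {f g} → (∀ w → f w ≡ g w) → Q f ≡ Q g

  extensional-∘insert : ∀ {Q} x → Extensional Q → Extensional (Q ∘ insert x)
  extensional-∘insert x ext f≗g = ext (insert-cong x f≗g)

  countSubsets-∷ : ∀ Q x xs → countSubsets Q (x ∷ xs) ≡ countSubsets Q xs + countSubsets (Q ∘ insert x) xs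
  countSubsets-∷ Q x xs = ≡.trans (count-++ (Q ∘ memb) (sublists xs) _)
                                  (cong (countSubsets Q xs +_) (count-map (Q ∘ memb) (x ∷_) (sublists xs)))

  countSubsets-cong : ∀ {Q R} xs → (∀ {S} → S ∈ sublists xs → Q (memb S) ≡ R (memb S)) →
                      countSubsets Q xs ≡ countSubsets R xs
  countSubsets-cong xs = count-cong (sublists xs)

  memb-⊆ : ∀ xs {S} → S ∈ sublists xs → memb S ⊆ᴸ xs
  memb-⊆ []       (here refl) ()
  memb-⊆ []       (there ())
  memb-⊆ (x ∷ xs) S∈ with ∈-++⁻ (sublists xs) S∈
  ... | inj₁ S∈ₗ = λ Sw → there (memb-⊆ xs S∈ₗ Sw)
  ... | inj₂ S∈ᵣ with ∈-map⁻ (x ∷_) S∈ᵣ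
  ...   | _ , S∈ₗ , refl = insert-⊆ (memb-⊆ xs S∈ₗ)

  memb-∉ : ∀ xs {S x} → S ∈ sublists xs → x ∉ xs → memb S x ≡ false
  memb-∉ xs S∈ = ⊆-∉ (memb-⊆ xs S∈)

  sublist-of : ∀ xs {f} → f ⊆ᴸ xs → ∃ λ S → S ∈ sublists xs × (∀ w → memb S w ≡ f w)
  sublist-of []       f⊆ = [] , here refl , λ w → sym (⊆-[] f⊆ w)
  sublist-of (x ∷ xs) {f} f⊆ with sublist-of xs (erase-⊆ f⊆) | f x in fx
  ... | S , S∈ , S≗ | true  = x ∷ S , ∈-++⁺ʳ _ (∈-map⁺ (x ∷_) S∈) ,
                              λ w → ≡.trans (insert-cong x S≗ w) (insert-erase fx w)
  ... | S , S∈ , S≗ | false = S , ∈-++⁺ˡ S∈ , λ w → ≡.trans (S≗ w) (erase-id fx w)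

  countSubsets-↭ : ∀ {Q} → Extensional Q → ∀ {xs ys} → xs ↭ ys → countSubsets Q xs ≡ countSubsets Q ys
  countSubsets-↭ ext refl = refl
  countSubsets-↭ {Q} ext (prep {xs = xs} {ys = ys} x p) = ≡.trans (countSubsets-∷ Q x xs) (≡.trans
    (cong₂ _+_ (countSubsets-↭ ext p) (countSubsets-↭ (extensional-∘insert x ext) p))
    (sym (countSubsets-∷ Q x ys)))
  countSubsets-↭ {Q} ext (swap {xs = xs} {ys = ys} x y p) = begin
    countSubsets Q (x ∷ y ∷ xs)                 ≡⟨ countSubsets-∷∷ x y xs ⟩
    (N Q xs + N Qy xs) + (N Qx xs + N Qxy xs)  ≡⟨ cong₂ _+_ (cong₂ _+_ (IH ext) (IH exty)) (cong₂ _+_ (IH extx) (IH extxy)) ⟩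
    (N Q ys + N Qy ys) + (N Qx ys + N Qxy ys)  ≡⟨ cong (λ m → (N Q ys + N Qy ys) + (N Qx ys + m))
                                                         (countSubsets-cong {Qxy} {Qyx} ys λ _ → ext (insert-comm x y _)) ⟩
    (N Q ys + N Qy ys) + (N Qx ys + N Qyx ys)  ≡⟨ interchange +-commutativeSemigroup (N Q ys) _ _ _ ⟩
    (N Q ys + N Qx ys) + (N Qy ys + N Qyx ys)  ≡⟨ sym (countSubsets-∷∷ y x ys) ⟩
    countSubsets Q (y ∷ x ∷ ys)                 ∎
    where
    N = countSubsets
    Qx = Q ∘ insert x
    Qy = Q ∘ insert y
    Qxy = Q ∘ insert x ∘ insert y
    Qyx = Q ∘ insert y ∘ insert x
    extx = extensional-∘insert x ext
    exty = extensional-∘insert y ext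
    extxy = extensional-∘insert y extx
    IH : ∀ {R} → Extensional R → N R xs ≡ N R ys
    IH extR = countSubsets-↭ extR p
    countSubsets-∷∷ : ∀ x y xs → N Q (x ∷ y ∷ xs) ≡
      (N Q xs + N (Q ∘ insert y) xs) + (N (Q ∘ insert x) xs + N (Q ∘ insert x ∘ insert y) xs)
    countSubsets-∷∷ x y xs = ≡.trans (countSubsets-∷ Q x (y ∷ xs))
      (cong₂ _+_ (countSubsets-∷ Q y xs) (countSubsets-∷ (Q ∘ insert x) y xs))
  countSubsets-↭ ext (trans p q) = ≡.trans (countSubsets-↭ ext p) (countSubsets-↭ ext q)

  countSubsets-⊕ : ∀ {Q} → Extensional Q → ∀ {xs g} → Unique xs → g ⊆ᴸ xs →
                   countSubsets (λ f → Q (f ⊕ g)) xs ≡ countSubsets Q xs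
  countSubsets-⊕ {Q} ext {[]} {g} _ g⊆ =
    countSubsets-cong {λ f → Q (f ⊕ g)} {Q} [] λ { (here refl) → ext (⊆-[] g⊆) ; (there ()) }
  countSubsets-⊕ {Q} ext {x ∷ xs} {g} uniq@(_ ∷ uniqᵗ) g⊆ = by-cases (g x) refl
    where
    N = countSubsets
    Q⊕g = λ f → Q (f ⊕ g)
    g′ = erase x g
    IH = countSubsets-⊕ ext uniqᵗ (erase-⊆ g⊆)
    IHₓ = countSubsets-⊕ (extensional-∘insert x ext) uniqᵗ (erase-⊆ g⊆)
    on-sublists : ∀ {R₁ R₂} → (∀ f → f x ≡ false → R₁ f ≡ R₂ f) → N R₁ xs ≡ N R₂ xs
    on-sublists {R₁} {R₂} R₁≗R₂ = countSubsets-cong {R₁} {R₂} xs λ {S} S∈ →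
      R₁≗R₂ (memb S) (memb-∉ xs S∈ (Unique[x∷xs]⇒x∉xs uniq))
    by-cases : ∀ b → g x ≡ b → N Q⊕g (x ∷ xs) ≡ N Q (x ∷ xs)
    by-cases false gx = begin
      N Q⊕g (x ∷ xs)                                   ≡⟨ countSubsets-∷ Q⊕g x xs ⟩
      N Q⊕g xs + N (Q⊕g ∘ insert x) xs                 ≡⟨ cong₂ _+_ (on-sublists λ f _ → ext (⊕≗⊕-erase {x} f gx))
                                                                    (on-sublists λ f _ → ext (insert-⊕≗insert-⊕-erase {x} f gx)) ⟩
      N (λ f → Q (f ⊕ g′)) xs + N (λ f → Q (insert x (f ⊕ g′))) xs ≡⟨ cong₂ _+_ IH IHₓ ⟩
      N Q xs + N (Q ∘ insert x) xs                      ≡⟨ sym (countSubsets-∷ Q x xs) ⟩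
      N Q (x ∷ xs)                                      ∎
    by-cases true gx = begin
      N Q⊕g (x ∷ xs)                                   ≡⟨ countSubsets-∷ Q⊕g x xs ⟩
      N Q⊕g xs + N (Q⊕g ∘ insert x) xs                 ≡⟨ cong₂ _+_ (on-sublists λ f fx → ext (⊕≗insert-⊕-erase {x} {f} fx gx))
                                                                    (on-sublists λ f fx → ext (insert-⊕≗⊕-erase {x} {f} fx gx)) ⟩
      N (λ f → Q (insert x (f ⊕ g′))) xs + N (λ f → Q (f ⊕ g′)) xs ≡⟨ cong₂ _+_ IHₓ IH ⟩
      N (Q ∘ insert x) xs + N Q xs                      ≡⟨ +-comm (N (Q ∘ insert x) xs) (N Q xs) ⟩
      N Q xs + N (Q ∘ insert x) xs                      ≡⟨ sym (countSubsets-∷ Q x xs) ⟩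
      N Q (x ∷ xs)                                      ∎

  countSubsets-only-∅ : ∀ {Q} → Q ∅ ≡ true → ∀ xs → (∀ {f} → Q f ≡ true → f ⊆ᴸ xs → ∀ w → f w ≡ false) →
                        countSubsets Q xs ≡ 1
  countSubsets-only-∅ Q∅ [] _ rewrite Q∅ = refl
  countSubsets-only-∅ {Q} Q∅ (x ∷ xs) only-∅ = begin
    countSubsets Q (x ∷ xs)                             ≡⟨ countSubsets-∷ Q x xs ⟩
    countSubsets Q xs + countSubsets (Q ∘ insert x) xs  ≡⟨ cong₂ _+_ IH (count-none (sublists xs) no-x) ⟩
    1 + 0                                               ∎
    where
    IH = countSubsets-only-∅ Q∅ xs λ Qf f⊆ → only-∅ Qf (λ fw → there (f⊆ fw))
    no-x : ∀ {S} → S ∈ sublists xs → Q (insert x (memb S)) ≡ false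
    no-x {S} S∈ with Q (insert x (memb S)) in Qx
    ... | false = refl
    ... | true  = contradiction (≡.trans (sym (insert-self x (memb S))) (only-∅ Qx (insert-⊆ (memb-⊆ xs S∈)) x)) λ ()

  count-insert : ∀ {T r} → T r ≡ false → ∀ {xs} → r ∈ xs → Unique xs → count (insert r T) xs ≡ suc (count T xs)
  count-insert {T} {r} Tr {r ∷ xs} (here refl) (r∉ ∷ _) with r ≟ʷ r
  ... | no r≢r = contradiction refl r≢r
  ... | yes _ rewrite Tr =
    cong suc (count-cong {p = insert r T} {q = T} xs λ w∈ → insert-≢ T λ w≡r → All.lookup r∉ w∈ (sym w≡r))
  count-insert {T} {r} Tr {x ∷ xs} (there r∈) (x∉ ∷ uniq) with x ≟ʷ r
  ... | yes refl = contradiction refl (All.lookup x∉ r∈)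
  ... | no _ with T x
  ...   | true  = cong suc (count-insert Tr r∈ uniq)
  ...   | false = count-insert Tr r∈ uniq

  record Linear (Q : Subset n → Bool) : Set where
    field
      extensional : Extensional Q
      contains-∅  : Q ∅ ≡ true
      closed-⊕    : ∀ {f g} → Q f ≡ true → Q g ≡ true → Q (f ⊕ g) ≡ true

  module _ {Q : Subset n → Bool} (linear : Linear Q) where
    open Linear linear

    ⊕-invariant : ∀ {a} → Q a ≡ true → ∀ f → Q (f ⊕ a) ≡ Q f
    ⊕-invariant {a} Qa f = ⇔→≡ (mk⇔
      (λ Qf⊕a → ≡.trans (sym (extensional (⊕-cancelʳ f a))) (closed-⊕ Qf⊕a Qa))
      (λ Qf → closed-⊕ Qf Qa))

    countSubsets-insert : ∀ {x xs g} → x ∉ xs → Unique xs → g ⊆ᴸ xs → Q (insert x g) ≡ true →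
                          countSubsets (Q ∘ insert x) xs ≡ countSubsets Q xs
    countSubsets-insert {x} {xs} {g} x∉ uniq g⊆ Qxg = ≡.trans
      (countSubsets-cong {Q ∘ insert x} {λ f → Q (f ⊕ g)} xs λ {S} S∈ →
        ≡.trans (extensional (insert≗⊕ (memb-∉ xs S∈ x∉) (⊆-∉ g⊆ x∉))) (⊕-invariant Qxg (memb S ⊕ g)))
      (countSubsets-⊕ extensional uniq g⊆)

    record Pivoting (R B : List (Word n)) : Set where
      field
        pivots              : Subset n
        pivots-⊆            : pivots ⊆ᴸ R
        countSubsets-factor : countSubsets Q (R ++ B) ≡ countSubsets Q B * 2 ^ ∣ pivots ∣
        disjoint⇒⊆          : ∀ {u} → Q u ≡ true → u ⊆ᴸ (R ++ B) → Disjoint u pivots → u ⊆ᴸ B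

    pivoting-skip : ∀ {r R B} → Pivoting R B →
                    (∀ {S} → S ∈ sublists (R ++ B) → Q (insert r (memb S)) ≡ false) → Pivoting (r ∷ R) B
    pivoting-skip {r} {R} {B} P none = record
      { pivots              = pivots
      ; pivots-⊆            = λ Tw → there (pivots-⊆ Tw)
      ; countSubsets-factor = begin
          countSubsets Q (r ∷ R ++ B)                                       ≡⟨ countSubsets-∷ Q r (R ++ B) ⟩
          countSubsets Q (R ++ B) + countSubsets (Q ∘ insert r) (R ++ B)    ≡⟨ cong (countSubsets Q (R ++ B) +_)
                                                                                    (count-none (sublists (R ++ B)) none) ⟩
          countSubsets Q (R ++ B) + 0                                       ≡⟨ +-identityʳ _ ⟩
          countSubsets Q (R ++ B)                                           ≡⟨ countSubsets-factor ⟩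
          countSubsets Q B * 2 ^ ∣ pivots ∣                                 ∎
      ; disjoint⇒⊆          = disjoint⇒⊆ᵣ
      }
      where
      open Pivoting P
      disjoint⇒⊆ᵣ : ∀ {u} → Q u ≡ true → u ⊆ᴸ (r ∷ R ++ B) → Disjoint u pivots → u ⊆ᴸ B
      disjoint⇒⊆ᵣ {u} Qu u⊆ u∩T with u r in ur
      ... | false = disjoint⇒⊆ Qu (⊆-∷⁻ ur u⊆) u∩T
      ... | true with sublist-of (R ++ B) (erase-⊆ u⊆)
      ...   | S , S∈ , S≗ = contradiction
                (≡.trans (sym (none S∈)) (≡.trans (extensional λ w → ≡.trans (insert-cong r S≗ w) (insert-erase ur w)) Qu))
                λ ()

    pivoting-extend : ∀ {r R B S} → r ∉ R ++ B → Unique (R ++ B) → Pivoting R B →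
                      S ∈ sublists (R ++ B) → Q (insert r (memb S)) ≡ true → Pivoting (r ∷ R) B
    pivoting-extend {r} {R} {B} {S} r∉ uniq P S∈ QrS = record
      { pivots              = insert r pivots
      ; pivots-⊆            = insert-⊆ pivots-⊆
      ; countSubsets-factor = begin
          countSubsets Q (r ∷ R ++ B)                                       ≡⟨ countSubsets-∷ Q r (R ++ B) ⟩
          countSubsets Q (R ++ B) + countSubsets (Q ∘ insert r) (R ++ B)    ≡⟨ cong (countSubsets Q (R ++ B) +_)
                                                                                    (countSubsets-insert r∉ uniq (memb-⊆ _ S∈) QrS) ⟩
          countSubsets Q (R ++ B) + countSubsets Q (R ++ B)                 ≡⟨ cong₂ _+_ countSubsets-factor countSubsets-factor ⟩
          M * 2 ^ t + M * 2 ^ t                                             ≡⟨ cong (λ y → M * 2 ^ t + M * y)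
                                                                                    (sym (+-identityʳ (2 ^ t))) ⟩
          M * 2 ^ t + M * (2 ^ t + 0)                                       ≡⟨ sym (*-distribˡ-+ M (2 ^ t) (2 ^ t + 0)) ⟩
          M * 2 ^ suc t                                                     ≡⟨ cong (λ k → M * 2 ^ k) (sym ∣insert∣) ⟩
          M * 2 ^ ∣ insert r pivots ∣                                       ∎
      ; disjoint⇒⊆          = λ Qu u⊆ u∩T →
          disjoint⇒⊆ Qu (⊆-∷⁻ (u∩T (insert-self r pivots)) u⊆) (λ Tw → u∩T (insert-extends pivots Tw))
      }
      where
      open Pivoting P
      M = countSubsets Q B
      t = ∣ pivots ∣
      ∣insert∣ : ∣ insert r pivots ∣ ≡ suc t
      ∣insert∣ = count-insert (⊆-∉ pivots-⊆ λ r∈R → r∉ (∈-++⁺ˡ r∈R)) (allWords-complete n r) (allWords-unique n)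

    pivoting : ∀ R B → Unique (R ++ B) → Pivoting R B
    pivoting [] B _ = record
      { pivots              = ∅
      ; pivots-⊆            = λ ()
      ; countSubsets-factor = sym (≡.trans (cong (λ k → countSubsets Q B * 2 ^ k) (count-none (allWords n) λ _ → refl))
                                           (*-identityʳ _))
      ; disjoint⇒⊆          = λ _ u⊆ _ → u⊆
      }
    pivoting (r ∷ R) B uniq@(_ ∷ uniqᵗ) with none-or-witness (λ S → Q (insert r (memb S))) (sublists (R ++ B))
    ... | inj₁ none               = pivoting-skip (pivoting R B uniqᵗ) none
    ... | inj₂ (S , S∈ , QrS)     = pivoting-extend (Unique[x∷xs]⇒x∉xs uniq) uniqᵗ (pivoting R B uniqᵗ) S∈ QrS

    record PivotSet (P : Subset n) : Set where
      field
        pivots              : Subset n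
        pivots-outside      : ∀ {w} → pivots w ≡ true → P w ≡ false
        countSubsets-factor : countSubsets Q (allWords n) ≡ countSubsets Q (filterᵇ P (allWords n)) * 2 ^ ∣ pivots ∣
        disjoint⇒inside     : ∀ {u} → Q u ≡ true → Disjoint u pivots → ∀ {w} → u w ≡ true → P w ≡ true

    pivotSet : ∀ P → PivotSet P
    pivotSet P = record
      { pivots              = pivots
      ; pivots-outside      = λ Tw → not-injective (∈-filterᵇ⁻ (not ∘ P) {allWords n} (pivots-⊆ Tw))
      ; countSubsets-factor = ≡.trans (sym (countSubsets-↭ extensional split)) countSubsets-factor
      ; disjoint⇒inside     = λ Qu u∩T uw → ∈-filterᵇ⁻ P {allWords n} (disjoint⇒⊆ Qu (λ {w} _ → everywhere w) u∩T uw)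
      }
      where
      R = filterᵇ (not ∘ P) (allWords n)
      B = filterᵇ P (allWords n)
      split : R ++ B ↭ allWords n
      split = filterᵇ-complement-↭ (λ w → sym (not-involutive (P w))) (allWords n)
      everywhere : ∀ w → w ∈ R ++ B
      everywhere w = Any-resp-↭ (↭-sym split) (allWords-complete n w)
      open Pivoting (pivoting R B (Unique-resp-↭ (↭-sym split) (allWords-unique n)))

EvenLines : ∀ {n} → Subset n → Set
EvenLines {n} f = ∀ (w : Word n) i → odd (lineCount f w i) ≡ false

module _ {n : ℕ} where

  unitrade⇒evenLines : ∀ {f : Subset n} → Unitrade f → EvenLines f
  unitrade⇒evenLines {f} unitrade w i = not-injective (≡.trans (sym (%2≡ᵇ0≡not-odd (lineCount f w i)))
    (all-≡-true⁻ (λ i → lineCount f w i % 2 ≡ᵇ 0) (allFin n)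
      (all-≡-true⁻ (λ w → all (λ i → lineCount f w i % 2 ≡ᵇ 0) (allFin n)) (allWords n) unitrade (allWords-complete n w))
      (∈-allFin i)))

  evenLines⇒unitrade : ∀ {f : Subset n} → EvenLines f → Unitrade f
  evenLines⇒unitrade {f} even =
    all-≡-true⁺ (λ w → all (λ i → lineCount f w i % 2 ≡ᵇ 0) (allFin n)) (allWords n) λ {w} _ →
    all-≡-true⁺ (λ i → lineCount f w i % 2 ≡ᵇ 0) (allFin n) λ {i} _ →
    ≡.trans (%2≡ᵇ0≡not-odd (lineCount f w i)) (cong not (even w i))

  evenLines-cong : ∀ {f g : Subset n} → (∀ w → f w ≡ g w) → EvenLines f → EvenLines g
  evenLines-cong f≗g even w i = ≡.trans (cong odd (count-cong (allFin 4) λ {a} _ → sym (f≗g (w [ i ]≔ a)))) (even w i)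

  evenLines-⊕ : ∀ {f g : Subset n} → EvenLines f → EvenLines g → EvenLines (f ⊕ g)
  evenLines-⊕ {f} {g} f-even g-even w i = ≡.trans
    (odd-count-xor (λ a → f (w [ i ]≔ a)) (λ a → g (w [ i ]≔ a)) (allFin 4))
    (cong₂ _xor_ (f-even w i) (g-even w i))

  doubleMDS-⊕-unitrade : ∀ {C₁ C₂ : Subset n} → DoubleMDS C₁ → DoubleMDS C₂ → Unitrade (C₁ ⊕ C₂)
  doubleMDS-⊕-unitrade {C₁} {C₂} C₁-code C₂-code =
    evenLines⇒unitrade {C₁ ⊕ C₂} (evenLines-⊕ {C₁} {C₂} (cong odd ∘₂ C₁-code) (cong odd ∘₂ C₂-code))

  unitrade-linear : Linear (isUnitrade {n})
  unitrade-linear = record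
    { extensional = λ {f} {g} f≗g → ⇔→≡ (mk⇔
        (λ Uf → evenLines⇒unitrade {g} (evenLines-cong {f} {g} f≗g (unitrade⇒evenLines {f} Uf)))
        (λ Ug → evenLines⇒unitrade {f} (evenLines-cong {g} {f} (sym ∘ f≗g) (unitrade⇒evenLines {g} Ug))))
    ; contains-∅  = evenLines⇒unitrade {∅} λ _ _ → refl
    ; closed-⊕    = λ {f} {g} Uf Ug →
        evenLines⇒unitrade {f ⊕ g} (evenLines-⊕ {f} {g} (unitrade⇒evenLines {f} Uf) (unitrade⇒evenLines {g} Ug))
    }

isThree : Σ → Bool
isThree (suc (suc (suc zero))) = true
isThree _                      = false

threeFree : ∀ {n} → Word n → Bool
threeFree []      = true
threeFree (a ∷ w) = not (isThree a) ∧ threeFree w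

threeFree-count : ∀ n → count threeFree (allWords n) ≡ 3 ^ n
threeFree-count zero    = refl
threeFree-count (suc n) = begin
  count threeFree (allWords (suc n))               ≡⟨ count-cartesianProductWith threeFree _∷_ (allFin 4) (allWords n) ⟩
  c + (c + (c + (count (λ _ → false) (allWords n) + 0))) ≡⟨ cong (λ z → c + (c + (c + (z + 0))))
                                                                  (count-none (allWords n) λ _ → refl) ⟩
  c + (c + (c + 0))                                ≡⟨ cong (λ z → z + (z + (z + 0))) (threeFree-count n) ⟩
  3 ^ suc n                                        ∎
  where
  c = count threeFree (allWords n)

last-of-even-line : ∀ (h : Σ → Bool) → h zero ≡ false → h (suc zero) ≡ false → h (suc (suc zero)) ≡ false →
                    odd (count h (allFin 4)) ≡ false → h (suc (suc (suc zero))) ≡ false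
last-of-even-line h h0 h1 h2 even rewrite h0 | h1 | h2 with h (suc (suc (suc zero)))
... | false = refl
... | true  = contradiction even λ ()

evenLines-vanishing-on-threeFree : ∀ n {u : Subset n} → EvenLines u →
                                   (∀ {w} → threeFree w ≡ true → u w ≡ false) → ∀ w → u w ≡ false
evenLines-vanishing-on-threeFree zero    even u∩ [] = u∩ refl
evenLines-vanishing-on-threeFree (suc n) {u} even u∩ (a ∷ w) = on-letter a
  where
  slice : ∀ b → isThree b ≡ false → ∀ v → u (b ∷ v) ≡ false
  slice b b≢3 = evenLines-vanishing-on-threeFree n (λ v i → even (b ∷ v) (suc i))
                  λ {v} tv → u∩ (≡.trans (cong (λ t → not t ∧ threeFree v) b≢3) tv)
  on-letter : ∀ a → u (a ∷ w) ≡ false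
  on-letter zero                   = slice zero refl w
  on-letter (suc zero)             = slice (suc zero) refl w
  on-letter (suc (suc zero))       = slice (suc (suc zero)) refl w
  on-letter (suc (suc (suc zero))) = last-of-even-line (λ c → u (c ∷ w))
    (slice zero refl w) (slice (suc zero) refl w) (slice (suc (suc zero)) refl w) (even (suc (suc (suc zero)) ∷ w) zero)

boxLetter : Σ → Σ → Bool
boxLetter y a = does (a ≟ᶠ y) ∨ isThree a

box : ∀ {n} → Word n → Subset n
box []       []      = true
box (y ∷ ys) (a ∷ w) = boxLetter y a ∧ box ys w

box-evenLines : ∀ {n} (y : Word n) → threeFree y ≡ true → EvenLines (box y)
box-evenLines (y ∷ ys) ty (a ∷ w) zero with box ys w
... | true  = line {y} (not-injective (proj₁ (∧-true⁻ (not (isThree y)) ty)))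
  where
  line : ∀ {y} → isThree y ≡ false → odd (count (λ c → boxLetter y c ∧ true) (allFin 4)) ≡ false
  line {zero}                   _ = refl
  line {suc zero}               _ = refl
  line {suc (suc zero)}         _ = refl
  line {suc (suc (suc zero))} ()
... | false = cong odd (count-none (allFin 4) λ {c} _ → ∧-zeroʳ (boxLetter y c))
box-evenLines (y ∷ ys) ty (a ∷ w) (suc i) with boxLetter y a
... | true  = box-evenLines ys (proj₂ (∧-true⁻ (not (isThree y)) ty)) w i
... | false = refl

box-self : ∀ {n} (y : Word n) → box y y ≡ true
box-self []       = refl
box-self (y ∷ ys) with y ≟ᶠ y
... | yes _   = box-self ys
... | no y≢y = contradiction refl y≢y

box-threeFree : ∀ {n} (y w : Word n) → threeFree w ≡ true → box y w ≡ true → w ≡ y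
box-threeFree []       []      _  _  = refl
box-threeFree (y ∷ ys) (a ∷ w) tw bw =
  cong₂ _∷_ a≡y (box-threeFree ys w (proj₂ (∧-true⁻ (not (isThree a)) tw)) (proj₂ (∧-true⁻ (boxLetter y a) bw)))
  where
  a≡y : a ≡ y
  a≡y with a ≟ᶠ y | proj₁ (∧-true⁻ (boxLetter y a) bw)
  ... | yes a≡y | _   = a≡y
  ... | no _    | a≡3 = contradiction (≡.trans (sym a≡3) (not-injective (proj₁ (∧-true⁻ (not (isThree a)) tw)))) λ ()

unitrades-count : ∀ n → countSubsets isUnitrade (allWords n) ≡ 2 ^ 3 ^ n
unitrades-count n = begin
  countSubsets isUnitrade (allWords n)      ≡⟨ countSubsets-factor ⟩
  countSubsets isUnitrade B * 2 ^ ∣ pivots ∣ ≡⟨ cong₂ (λ m k → m * 2 ^ k) only-∅ pivots-count ⟩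
  1 * 2 ^ 3 ^ n                             ≡⟨ *-identityˡ (2 ^ 3 ^ n) ⟩
  2 ^ 3 ^ n                                 ∎
  where
  open PivotSet (pivotSet (unitrade-linear {n}) (not ∘ threeFree))
  B = filterᵇ (not ∘ threeFree) (allWords n)

  only-∅ : countSubsets isUnitrade B ≡ 1
  only-∅ = countSubsets-only-∅ (Linear.contains-∅ (unitrade-linear {n})) B λ {f} Uf f⊆ →
    evenLines-vanishing-on-threeFree n (unitrade⇒evenLines {f = f} Uf) λ tw →
      ⊆-∉ f⊆ λ w∈B → contradiction (≡.trans (cong not (sym tw)) (∈-filterᵇ⁻ (not ∘ threeFree) {allWords n} w∈B)) λ ()

  pivot⇒threeFree : ∀ {w} → pivots w ≡ true → threeFree w ≡ true
  pivot⇒threeFree Tw = not-injective (pivots-outside Tw)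

  threeFree⇒pivot : ∀ {w} → threeFree w ≡ true → pivots w ≡ true
  threeFree⇒pivot {w} tw with pivots w in Tw
  ... | true  = refl
  ... | false = contradiction (≡.trans (cong not (sym tw)) (disjoint⇒inside box-unitrade box∩T (box-self w))) λ ()
    where
    box-unitrade : Unitrade (box w)
    box-unitrade = evenLines⇒unitrade {f = box w} (box-evenLines w tw)
    box∩T : Disjoint (box w) pivots
    box∩T {v} Tv with box w v in bv
    ... | false = refl
    ... | true with box-threeFree w v (pivot⇒threeFree Tv) bv
    ...   | refl = contradiction (≡.trans (sym Tv) Tw) λ ()

  pivots-count : ∣ pivots ∣ ≡ 3 ^ n
  pivots-count = ≡.trans (count-cong {p = pivots} {q = threeFree} (allWords n) λ {w} _ →
    ⇔→≡ (mk⇔ (pivot⇒threeFree {w}) (threeFree⇒pivot {w}))) (threeFree-count n)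

∧-agree⇒xor≡false : ∀ {t a b} → t ≡ true → (t ∧ a) ≡ (t ∧ b) → a xor b ≡ false
∧-agree⇒xor≡false {b = b} refl a≡b rewrite a≡b = xor-same b

xor≡false⇒≡ : ∀ {a b} → a xor b ≡ false → a ≡ b
xor≡false⇒≡ {false} {false} _ = refl
xor≡false⇒≡ {true}  {true}  _ = refl

proposition1 : ∀ (n : ℕ) → 1 ≤ n → (D : Subset n) → Unitrade D → NoCodePairIn D →
    (k : ℕ) → numUnitradeSubsets D ≡ 2 ^ k →
    ∃ λ (T : Subset n) → (∀ w → T w ≡ true → D w ≡ false) × TestingSet T ×
      ∣ T ∣ + k ≡ 3 ^ n
proposition1 n _ D _ no-code-pair k #D≡2^k = pivots , (λ _ → pivots-outside) , testing , size
  where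
  open PivotSet (pivotSet unitrade-linear D)

  size : ∣ pivots ∣ + k ≡ 3 ^ n
  size = 2^-injective (begin
    2 ^ (∣ pivots ∣ + k)                 ≡⟨ ^-distribˡ-+-* 2 ∣ pivots ∣ k ⟩
    2 ^ ∣ pivots ∣ * 2 ^ k               ≡⟨ *-comm (2 ^ ∣ pivots ∣) (2 ^ k) ⟩
    2 ^ k * 2 ^ ∣ pivots ∣               ≡⟨ cong (_* 2 ^ ∣ pivots ∣) (sym #D≡2^k) ⟩
    numUnitradeSubsets D * 2 ^ ∣ pivots ∣ ≡⟨ sym countSubsets-factor ⟩
    countSubsets isUnitrade (allWords n) ≡⟨ unitrades-count n ⟩
    2 ^ 3 ^ n                            ∎)

  testing : TestingSet pivots
  testing C₁ C₂ C₁-code C₂-code C₁≢C₂ agree = no-code-pair (C₁ , C₂ , C₁-code , C₂-code , differ , inside)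
    where
    inside : ∀ w → (C₁ w xor C₂ w) ≡ true → D w ≡ true
    inside w = disjoint⇒inside (doubleMDS-⊕-unitrade {C₁ = C₁} {C₂} C₁-code C₂-code) λ {v} Tv →
      ∧-agree⇒xor≡false Tv (agree v)
    differ : ∃ λ w → (C₁ w xor C₂ w) ≡ true
    differ with none-or-witness (C₁ ⊕ C₂) (allWords n)
    ... | inj₁ none              = contradiction (λ w → xor≡false⇒≡ (none (allWords-complete n w))) C₁≢C₂
    ... | inj₂ (w , _ , differs) = w , differs
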